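{- (i) $|\gamma^{dom}(\lambda)|\ge1$ for every $\lambda\in\Lambda$. (ii) $|\gamma^{dom}(\lambda\mu)|\le|\gamma^{dom}(\lambda)|\,|\gamma^{dom}(\mu)|$ for all $\lambda,\mu\in\Lambda$.
   Context: $L/\mathbb{Q}_p$ finite, $K\supseteq L$ complete with absolute value $|\cdot|$, $|\cdot|_L$ normalized absolute value. $G$: $L$-points of an $L$-split connected reductive group; $T$ maximal split torus, $P$ Borel containing $T$, $\Phi^+$ positive roots, $W$ Weyl group acting on $\Lambda$ by conjugation ($\lambda\mapsto{}^w\lambda$), $U_0$ maximal compact special w.r.t. $T$, $\Lambda=T/(U_0\cap T)$ with projection $\lambda:T\to\Lambda$ (written multiplicatively), $\Lambda^{ -- }=\lambda(\{t:|\alpha(t)|_L\ge1\ \forall\alpha\in\Phi^+\})$, a fundamental domain for $W$ on $\Lambda$. $\gamma:W\times\Lambda\to K^\times$ satisfies (a) $\gamma(w,\lambda\mu)=\gamma(w,\lambda)\gamma(w,\mu)$, (b) $\gamma(vw,\lambda)=\gamma(v,{}^w\lambda)\gamma(w,\lambda)$, (c) $|\gamma(w,\lambda)|\le1$ for $\lambda\in\Lambda^{ -- }$, (d) $\gamma(w,\lambda)=1$ if ${}^w\lambda=\lambda$. $\gamma^{dom}(\lambda):=\gamma(w,\lambda)$ for any $w\in W$ with ${}^w\lambda\in\Lambda^{ -- }$ (well defined by (d)). -}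

module Defs where

open import Data.Nat using (ℕ)
open import Data.Fin using (Fin)
open import Data.Product using (Σ; ∃; _×_)
open import Function.Bundles using (_↔_)
open import Relation.Binary.PropositionalEquality using (_≡_)
open import Relation.Binary.Structures using (IsTotalOrder)
open import Algebra.Structures using (IsGroup; IsAbelianGroup)

-- Abstract root-datum-free data of the paper's setting:
--  * Λ = T/(U₀ ∩ T), a commutative group written multiplicatively;
--  * W, the (finite) Weyl group, acting on Λ by group automorphisms (λ ↦ ʷλ);
--  * Λ⁻⁻ ⊆ Λ, a fundamental domain for the W-action.
record WeylData : Set₁ where
  infixl 7 _·_ _∘_
  field
    Λ      : Set
    _·_    : Λ → Λ → Λ
    1Λ     : Λ
    invΛ   : Λ → Λ
    Λ-isAbelianGroup : IsAbelianGroup _≡_ _·_ 1Λ invΛ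
    W      : Set
    _∘_    : W → W → W
    e      : W
    invW   : W → W
    W-isGroup : IsGroup _≡_ _∘_ e invW
    W-finite  : Σ ℕ (λ n → W ↔ Fin n)
    act      : W → Λ → Λ
    act-id   : ∀ l → act e l ≡ l
    act-comp : ∀ v w l → act (v ∘ w) l ≡ act v (act w l)
    act-hom  : ∀ w l m → act w (l · m) ≡ act w l · act w m
    Λ⁻⁻      : Λ → Set
    fund-meets : ∀ l → ∃ λ w → Λ⁻⁻ (act w l)
    fund-once  : ∀ l w → Λ⁻⁻ l → Λ⁻⁻ (act w l) → act w l ≡ l

-- The multiplicative group Kˣ of K together with its absolute value
-- |·| : Kˣ → V, where V (standing for the positive reals ℝ_{>0}) is a
-- totally ordered abelian group, and |·| is a group homomorphism.
record AbsData : Set₁ where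
  infixl 7 _*_ _⊗_
  infix 4 _≤_
  field
    Kˣ    : Set
    _*_   : Kˣ → Kˣ → Kˣ
    1K    : Kˣ
    invK  : Kˣ → Kˣ
    Kˣ-isAbelianGroup : IsAbelianGroup _≡_ _*_ 1K invK
    V     : Set
    _⊗_   : V → V → V
    1V    : V
    invV  : V → V
    V-isAbelianGroup : IsAbelianGroup _≡_ _⊗_ 1V invV
    _≤_   : V → V → Set
    ≤-isTotalOrder : IsTotalOrder _≡_ _≤_
    ⊗-mono : ∀ {a b} c → a ≤ b → a ⊗ c ≤ b ⊗ c
    ∣_∣    : Kˣ → V
    ∣∣-mult : ∀ x y → ∣ x * y ∣ ≡ ∣ x ∣ ⊗ ∣ y ∣
    ∣∣-one  : ∣ 1K ∣ ≡ 1V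

record Gamma (D : WeylData) (A : AbsData) : Set where
  open WeylData D
  open AbsData A
  field
    γ   : W → Λ → Kˣ
    γ-a : ∀ w l m → γ w (l · m) ≡ γ w l * γ w m
    γ-b : ∀ v w l → γ (v ∘ w) l ≡ γ v (act w l) * γ w l
    γ-c : ∀ w l → Λ⁻⁻ l → ∣ γ w l ∣ ≤ 1V
    γ-d : ∀ w l → act w l ≡ l → γ w l ≡ 1K

-- c is γ^dom(l): c = γ(w, l) for some w with ʷl ∈ Λ⁻⁻
-- (this is well defined by (d); we keep it as a relation).
IsGammaDom : {D : WeylData} {A : AbsData} → Gamma D A →
             AbsData.Kˣ A → WeylData.Λ D → Set
IsGammaDom {D} {A} G c l =
  ∃ λ w → WeylData.Λ⁻⁻ D (WeylData.act D w l) × (c ≡ Gamma.γ G w l)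

-- Write γ^dom(λ) = γ(v, λ) with ᵛλ ∈ Λ⁻⁻. For any u, the cocycle relation (b)
-- gives γ(u, λ) = γ(uv⁻¹, ᵛλ) γ(v, λ), and |γ(uv⁻¹, ᵛλ)| ≤ 1 by (c); so |γ(·, λ)|
-- is largest at a dominating element. Part (i) compares with u = 1, where
-- γ(1, λ) = 1 by (d); part (ii) factors γ^dom(λμ) = γ(u, λ) γ(u, μ) by (a) and
-- bounds each factor.
module Submission where

open import Defs
open import Data.Product using (_×_; _,_)
open import Relation.Binary.PropositionalEquality
open import Relation.Binary.Structures using (IsTotalOrder)
open import Algebra.Bundles using (Group)
open import Algebra.Structures using (IsAbelianGroup)
import Algebra.Properties.Group as GroupProperties

module OrderedValues (A : AbsData) where
  open AbsData A
  open IsAbelianGroup V-isAbelianGroup using (comm; identityˡ)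
  open IsTotalOrder ≤-isTotalOrder using () renaming (trans to ≤-trans)

  ⊗-monoʳ-≤ : ∀ c {a b} → a ≤ b → c ⊗ a ≤ c ⊗ b
  ⊗-monoʳ-≤ c {a} {b} a≤b = subst₂ _≤_ (comm a c) (comm b c) (⊗-mono c a≤b)

  ⊗-mono-≤ : ∀ {a b c d} → a ≤ b → c ≤ d → a ⊗ c ≤ b ⊗ d
  ⊗-mono-≤ {b = b} {c} a≤b c≤d = ≤-trans (⊗-mono c a≤b) (⊗-monoʳ-≤ b c≤d)

  ≤1⇒⊗-≤ : ∀ {a} b → a ≤ 1V → a ⊗ b ≤ b
  ≤1⇒⊗-≤ b a≤1 = subst (_ ⊗ b ≤_) (identityˡ b) (⊗-mono b a≤1)

module GammaDom {D : WeylData} {A : AbsData} (G : Gamma D A) where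
  open WeylData D
  open AbsData A
  open Gamma G
  open OrderedValues A

  weylGroup : Group _ _
  weylGroup = record
    { Carrier = W ; _≈_ = _≡_ ; _∙_ = _∘_ ; ε = e ; _⁻¹ = invW ; isGroup = W-isGroup }

  open Group weylGroup using (_//_)
  open GroupProperties weylGroup using (//-rightDividesˡ)

  γ-e≡1 : ∀ l → γ e l ≡ 1K
  γ-e≡1 l = γ-d e l (act-id l)

  γ-factor : ∀ u v l → γ u l ≡ γ (u // v) (act v l) * γ v l
  γ-factor u v l = begin
    γ u l                            ≡⟨ cong (λ w → γ w l) (sym (//-rightDividesˡ v u)) ⟩
    γ ((u // v) ∘ v) l               ≡⟨ γ-b (u // v) v l ⟩
    γ (u // v) (act v l) * γ v l     ∎
    where open ≡-Reasoning

  ∣γ∣≤∣γ-dom∣ : ∀ u v l → Λ⁻⁻ (act v l) → ∣ γ u l ∣ ≤ ∣ γ v l ∣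
  ∣γ∣≤∣γ-dom∣ u v l dom =
    subst (_≤ ∣ γ v l ∣) (sym (trans (cong ∣_∣ (γ-factor u v l)) (∣∣-mult _ _)))
          (≤1⇒⊗-≤ ∣ γ v l ∣ (γ-c (u // v) (act v l) dom))

  1≤∣γ-dom∣ : ∀ l c → IsGammaDom G c l → 1V ≤ ∣ c ∣
  1≤∣γ-dom∣ l _ (v , dom , refl) =
    subst (_≤ ∣ γ v l ∣) (trans (cong ∣_∣ (γ-e≡1 l)) ∣∣-one) (∣γ∣≤∣γ-dom∣ e v l dom)

  ∣γ-dom∣-submultiplicative : ∀ l m c a b → IsGammaDom G c (l · m) →
                              IsGammaDom G a l → IsGammaDom G b m → ∣ c ∣ ≤ ∣ a ∣ ⊗ ∣ b ∣
  ∣γ-dom∣-submultiplicative l m _ _ _ (u , _ , refl) (v , domˡ , refl) (w , domᵐ , refl) =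
    subst (_≤ ∣ γ v l ∣ ⊗ ∣ γ w m ∣) (sym (trans (cong ∣_∣ (γ-a u l m)) (∣∣-mult _ _)))
          (⊗-mono-≤ (∣γ∣≤∣γ-dom∣ u v l domˡ) (∣γ∣≤∣γ-dom∣ u w m domᵐ))

lemma2p1 : (D : WeylData) (A : AbsData) (G : Gamma D A) →
           (∀ l c → IsGammaDom G c l → AbsData._≤_ A (AbsData.1V A) (AbsData.∣_∣ A c))
           × (∀ l m c d e → IsGammaDom G c (WeylData._·_ D l m) → IsGammaDom G d l → IsGammaDom G e m →
              AbsData._≤_ A (AbsData.∣_∣ A c) (AbsData._⊗_ A (AbsData.∣_∣ A d) (AbsData.∣_∣ A e)))
lemma2p1 D A G = 1≤∣γ-dom∣ , ∣γ-dom∣-submultiplicative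
  where open GammaDom G
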